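{- Let $u,v$ be positive integers. For any $z_1,z_2\in[1/u,v]\cap\mathbb{Q}$, $$A^{(u,v)}(z_1;n)-A^{(u,v)}(z_2;n)\to 0\quad\text{as } n\to\infty,$$ where $A^{(u,v)}(z;n)=2^{ -n}\sum_{y\in\mathcal{T}^{(u,v)}(z;n)}y$.
   Context: The $(u,v)$-Calkin-Wilf tree $\mathcal{T}^{(u,v)}(z)$ with root a positive rational $z$ is the infinite binary tree whose root is labeled $z$ and in which every vertex labeled $a/b$ (with $a,b$ positive integers) has left child labeled $a/(ua+b)$ and right child labeled $(a+vb)/b$. $\mathcal{T}^{(u,v)}(z;n)$ denotes the collection of the $2^n$ vertices at depth $n$ (the root has depth $0$), and the sum runs over these $2^n$ vertices. -}

module Defs where

open import Data.Nat as ℕ using (ℕ; zero; suc; NonZero)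
open import Data.Nat.Properties using (m^n≢0)
open import Data.Integer as ℤ using (+_)
open import Data.Product using (_×_; _,_)
open import Data.List using (List; []; _∷_; _++_; map; foldr)
open import Data.Rational as ℚ using (ℚ; ↥_; ↧ₙ_; 0ℚ)

-- A vertex label a/b with a,b positive integers is stored as the pair
-- (a , d) with b = suc d, so the label is  a / (suc d).
Vertex : Set
Vertex = ℕ × ℕ

label : Vertex → ℚ
label (a , d) = (+ a) ℚ./ suc d

-- children in the (u,v)-Calkin-Wilf tree:
--   a/b  ↦  left  a/(ua+b) ,  right (a+vb)/b
leftChild : ℕ → Vertex → Vertex
leftChild u (a , d) = (a , u ℕ.* a ℕ.+ d)        -- u*a + (d+1) = suc (u*a + d)

rightChild : ℕ → Vertex → Vertex
rightChild v (a , d) = (a ℕ.+ v ℕ.* suc d , d)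

level : ℕ → ℕ → ℕ → Vertex → List Vertex
level u v zero     r = r ∷ []
level u v (suc n)  r = level u v n (leftChild u r) ++ level u v n (rightChild v r)

-- root vertex for a rational z (z > 0 intended): z = numerator / denominator
rootOf : ℚ → Vertex
rootOf z = (ℤ.∣ ↥ z ∣ , ℕ.pred (↧ₙ z))

T : ℕ → ℕ → ℚ → ℕ → List ℚ
T u v z n = map label (level u v n (rootOf z))

sumℚ : List ℚ → ℚ
sumℚ = foldr ℚ._+_ 0ℚ

inv2^ : ℕ → ℚ
inv2^ n = ℚ._/_ (+ 1) (2 ℕ.^ n) {{m^n≢0 2 n}}

A : ℕ → ℕ → ℚ → ℕ → ℚ
A u v z n = inv2^ n ℚ.* sumℚ (T u v z n)

-- Write δ for the difference of the labels of two vertices, and gₙ for the difference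
-- of the averages of the labels at depth n below them, so that gₙ₊₁ is the mean of gₙ
-- over the pair of left children and over the pair of right children.  A right move
-- adds v to a label, so it keeps δ and lands on a label ≥ 1/u.  A left move
-- a/b ↦ a/(ua+b) multiplies δ by b b' / ((ua+b)(ua'+b')), which is at most 1, and at
-- most 1/4 when both labels are ≥ 1/u.  A simultaneous induction then gives
-- |gₙ| ≤ (3/4)ⁿ δ for roots ≥ 1/u and |gₙ| ≤ 2 (3/4)ⁿ δ for arbitrary roots, and
-- (3/4)ⁿ → 0 by Bernoulli's inequality.
module Submission where

open import Defs
open import Algebra.Bundles using (CommutativeRing)
open import Data.Integer as ℤ using (ℤ; +_)
import Data.Integer.Properties as ℤP
open import Data.Integer.Solver using () renaming (module +-*-Solver to ℤ-Solver)
open import Data.List using ([]; _∷_; _++_; map)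
import Data.List.Properties as ListP
open import Data.Nat as ℕ using (ℕ; zero; suc; NonZero)
import Data.Nat.Properties as ℕP
open import Data.Product using (_,_; ∃-syntax)
open import Data.Rational as ℚ using (ℚ; mkℚ; _+_; _*_; _-_; _/_; _≤_; _<_; ∣_∣; 0ℚ; 1ℚ; ½)
import Data.Rational.Properties as ℚP
open import Data.Rational.Solver using () renaming (module +-*-Solver to ℚ-Solver)
open import Data.Rational.Unnormalised as ℚᵘ using (mkℚᵘ)
import Data.Rational.Unnormalised.Properties as ℚᵘP
open import Algebra.Definitions.RawSemiring ℚ.+-*-rawSemiring using (_^_; _×_)
open import Algebra.Properties.Semiring.Mult (CommutativeRing.semiring ℚP.+-*-commutativeRing)
  using (×-assoc-*; ×-comm-*)
open import Relation.Binary.PropositionalEquality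

toℚᵘ-/ : ∀ i n .{{_ : NonZero n}} → ℚ.toℚᵘ (i / n) ℚᵘ.≃ i ℚᵘ./ n
toℚᵘ-/ i (suc k) = ℚP.toℚᵘ-fromℚᵘ (mkℚᵘ i k)

toℚᵘ-homo-sub : ∀ p q → ℚ.toℚᵘ (p - q) ℚᵘ.≃ ℚ.toℚᵘ p ℚᵘ.- ℚ.toℚᵘ q
toℚᵘ-homo-sub p q =
  ℚᵘP.≃-trans (ℚP.toℚᵘ-homo-+ p (ℚ.- q)) (ℚᵘP.+-congʳ (ℚ.toℚᵘ p) (ℚP.toℚᵘ-homo‿- q))

+/≤+/ : ∀ {m n m' n'} .{{_ : NonZero n}} .{{_ : NonZero n'}} →
        m ℕ.* n' ℕ.≤ m' ℕ.* n → + m / n ≤ + m' / n'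
+/≤+/ {m} {suc k} {m'} {suc k'} h =
  ℚP.toℚᵘ-cancel-≤ (ℚᵘP.≤-respˡ-≃ (ℚᵘP.≃-sym (toℚᵘ-/ (+ m) (suc k)))
    (ℚᵘP.≤-respʳ-≃ (ℚᵘP.≃-sym (toℚᵘ-/ (+ m') (suc k')))
      (ℚᵘ.*≤* (subst₂ ℤ._≤_ (ℤP.pos-* m (suc k')) (ℤP.pos-* m' (suc k)) (ℤ.+≤+ h)))))

1/[m*n] : ∀ m n .{{_ : NonZero m}} .{{_ : NonZero n}} →
          ℚ._/_ (+ 1) (m ℕ.* n) {{ℕP.m*n≢0 m n}} ≡ (+ 1 / m) * (+ 1 / n)
1/[m*n] (suc m) (suc n) = ℚP.toℚᵘ-injective (begin
  ℚ.toℚᵘ (+ 1 / (suc m ℕ.* suc n))                ≈⟨ toℚᵘ-/ (+ 1) (suc m ℕ.* suc n) ⟩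
  mkℚᵘ (+ 1) m ℚᵘ.* mkℚᵘ (+ 1) n                   ≈⟨ ℚᵘP.*-cong (toℚᵘ-/ (+ 1) (suc m)) (toℚᵘ-/ (+ 1) (suc n)) ⟨
  ℚ.toℚᵘ (+ 1 / suc m) ℚᵘ.* ℚ.toℚᵘ (+ 1 / suc n)  ≈⟨ ℚP.toℚᵘ-homo-* (+ 1 / suc m) (+ 1 / suc n) ⟨
  ℚ.toℚᵘ ((+ 1 / suc m) * (+ 1 / suc n))          ∎)
  where open import Relation.Binary.Reasoning.Setoid ℚᵘP.≃-setoid

0≤q-p : ∀ {p q} → p ≤ q → 0ℚ ≤ q - p
0≤q-p {p} {q} p≤q = subst (_≤ q - p) (ℚP.+-inverseʳ p) (ℚP.+-monoˡ-≤ (ℚ.- p) p≤q)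

0<q-p : ∀ {p q} → p < q → 0ℚ < q - p
0<q-p {p} {q} p<q = subst (_< q - p) (ℚP.+-inverseʳ p) (ℚP.+-monoˡ-< (ℚ.- p) p<q)

p≤p+q : ∀ p {q} → 0ℚ ≤ q → p ≤ p + q
p≤p+q p {q} q≥0 = subst (_≤ p + q) (ℚP.+-identityʳ p) (ℚP.+-monoʳ-≤ p q≥0)

*-nonNeg : ∀ {p q} → 0ℚ ≤ p → 0ℚ ≤ q → 0ℚ ≤ p * q
*-nonNeg {p} {q} p≥0 q≥0 = ℚP.nonNegative⁻¹ _
  {{ℚP.nonNeg*nonNeg⇒nonNeg p {{ℚ.nonNegative p≥0}} q {{ℚ.nonNegative q≥0}}}}

*-mono-≤-nonNeg : ∀ {p q r s} → 0ℚ ≤ p → 0ℚ ≤ r → p ≤ q → r ≤ s → p * r ≤ q * s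
*-mono-≤-nonNeg {p} {q} {r} {s} p≥0 r≥0 p≤q r≤s = ℚP.≤-trans
  (ℚP.*-monoʳ-≤-nonNeg r {{ℚ.nonNegative r≥0}} p≤q)
  (ℚP.*-monoˡ-≤-nonNeg q {{ℚ.nonNegative (ℚP.≤-trans p≥0 p≤q)}} r≤s)

×-nonNeg : ∀ {x} → 0ℚ ≤ x → ∀ n → 0ℚ ≤ n × x
×-nonNeg x≥0 zero    = ℚP.≤-refl
×-nonNeg x≥0 (suc n) = ℚP.+-mono-≤ x≥0 (×-nonNeg x≥0 n)

×-monoˡ-≤ : ∀ {x} → 0ℚ ≤ x → ∀ {m n} → m ℕ.≤ n → m × x ≤ n × x
×-monoˡ-≤ x≥0 {n = n} ℕ.z≤n   = ×-nonNeg x≥0 n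
×-monoˡ-≤ {x} x≥0 (ℕ.s≤s m≤n) = ℚP.+-monoʳ-≤ x (×-monoˡ-≤ x≥0 m≤n)

^-nonNeg : ∀ {q} → 0ℚ ≤ q → ∀ n → 0ℚ ≤ q ^ n
^-nonNeg q≥0 zero    = ℚP.≤ᵇ⇒≤ _
^-nonNeg q≥0 (suc n) = *-nonNeg q≥0 (^-nonNeg q≥0 n)

bernoulli : ∀ {q} → 0ℚ ≤ q → q ≤ 1ℚ → ∀ n → q ^ n * (1ℚ + n × (1ℚ - q)) ≤ 1ℚ
bernoulli q≥0 q≤1 zero = ℚP.≤-refl
bernoulli {q} q≥0 q≤1 (suc n) = begin
  q * q ^ n * (1ℚ + (t + s))    ≡⟨ solve 3 (λ q p s → q :* p :* (con 1ℚ :+ ((con 1ℚ :- q) :+ s))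
                                                      := p :* (q :* (con 1ℚ :+ ((con 1ℚ :- q) :+ s))))
                                           refl q (q ^ n) s ⟩
  q ^ n * (q * (1ℚ + (t + s)))  ≤⟨ ℚP.*-monoˡ-≤-nonNeg (q ^ n) {{ℚ.nonNegative (^-nonNeg q≥0 n)}} step ⟩
  q ^ n * (1ℚ + s)              ≤⟨ bernoulli q≥0 q≤1 n ⟩
  1ℚ                            ∎
  where
  open ℚP.≤-Reasoning
  open ℚ-Solver
  t = 1ℚ - q
  s = n × t
  t≥0 : 0ℚ ≤ t
  t≥0 = 0≤q-p q≤1
  step : q * (1ℚ + (t + s)) ≤ 1ℚ + s
  step = begin
    q * (1ℚ + (t + s))                   ≤⟨ p≤p+q _ (ℚP.+-mono-≤ (*-nonNeg t≥0 t≥0) (*-nonNeg (×-nonNeg t≥0 n) t≥0)) ⟩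
    q * (1ℚ + (t + s)) + (t * t + s * t) ≡⟨ solve 2 (λ q s → q :* (con 1ℚ :+ ((con 1ℚ :- q) :+ s))
                                                     :+ ((con 1ℚ :- q) :* (con 1ℚ :- q) :+ s :* (con 1ℚ :- q))
                                                     := con 1ℚ :+ s) refl q s ⟩
    1ℚ + s                               ∎

toℚᵘ-×1 : ∀ n → ℚ.toℚᵘ (n × 1ℚ) ℚᵘ.≃ mkℚᵘ (+ n) 0
toℚᵘ-×1 zero    = ℚᵘP.≃-refl
toℚᵘ-×1 (suc n) = begin
  ℚ.toℚᵘ (1ℚ + n × 1ℚ)                  ≈⟨ ℚP.toℚᵘ-homo-+ 1ℚ (n × 1ℚ) ⟩
  ℚ.toℚᵘ 1ℚ ℚᵘ.+ ℚ.toℚᵘ (n × 1ℚ)       ≈⟨ ℚᵘP.+-congʳ (ℚ.toℚᵘ 1ℚ) (toℚᵘ-×1 n) ⟩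
  mkℚᵘ (+ 1) 0 ℚᵘ.+ mkℚᵘ (+ n) 0        ≈⟨ ℚᵘ.*≡* (cong (λ k → (+ 1 ℤ.+ k) ℤ.* + 1) (ℤP.*-identityʳ (+ n))) ⟩
  mkℚᵘ (+ suc n) 0                       ∎
  where open import Relation.Binary.Reasoning.Setoid ℚᵘP.≃-setoid

archimedean-1 : ∀ y → ∃[ N ] y < N × 1ℚ
archimedean-1 y@(mkℚ (+ m) d _) = suc m ,
  ℚP.toℚᵘ-cancel-< (ℚᵘP.<-respʳ-≃ (ℚᵘP.≃-sym (toℚᵘ-×1 (suc m)))
    (ℚᵘ.*<* (subst₂ ℤ._<_ (ℤP.pos-* m 1) (ℤP.pos-* (suc m) (suc d))
      (ℤ.+<+ (ℕP.<-≤-trans (ℕ.s≤s (ℕP.≤-reflexive (ℕP.*-identityʳ m))) (ℕP.m≤m*n (suc m) (suc d)))))))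
archimedean-1 y@(mkℚ ℤ.-[1+ m ] d _) = 0 , ℚP.negative⁻¹ y

archimedean : ∀ {t} → 0ℚ < t → ∀ y → ∃[ N ] y < N × t
archimedean {t} t>0 y = let N , y/t<N = archimedean-1 (y * ℚ.1/ t) in N , (begin-strict
  y                   ≡⟨ cancel ⟨
  y * ℚ.1/ t * t      <⟨ ℚP.*-monoˡ-<-pos t y/t<N ⟩
  N × 1ℚ * t          ≡⟨ ×-assoc-* N 1ℚ t ⟩
  N × (1ℚ * t)        ≡⟨ cong (N ×_) (ℚP.*-identityˡ t) ⟩
  N × t               ∎)
  where
  open ℚP.≤-Reasoning
  instance
    t-pos : ℚ.Positive t
    t-pos = ℚ.positive t>0
    t≢0 : ℚ.NonZero t
    t≢0 = ℚP.pos⇒nonZero t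
  cancel : y * ℚ.1/ t * t ≡ y
  cancel = trans (ℚP.*-assoc y (ℚ.1/ t) t)
             (trans (cong (y *_) (ℚP.*-inverseˡ t)) (ℚP.*-identityʳ y))

^*-eventually-< : ∀ {q} → 0ℚ ≤ q → q < 1ℚ → ∀ {K} → 0ℚ ≤ K → ∀ {ε} → 0ℚ < ε →
                  ∃[ N ] (∀ n → N ℕ.≤ n → q ^ n * K < ε)
^*-eventually-< {q} q≥0 q<1 {K} K≥0 {ε} ε>0 = let N , K<N×εt = archimedean εt>0 K in N , below K<N×εt
  where
  open ℚP.≤-Reasoning
  t = 1ℚ - q
  t>0 : 0ℚ < t
  t>0 = 0<q-p q<1
  εt>0 : 0ℚ < ε * t
  εt>0 = ℚP.positive⁻¹ _ {{ℚP.pos*pos⇒pos ε {{ℚ.positive ε>0}} t {{ℚ.positive t>0}}}}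
  below : ∀ {N} → K < N × (ε * t) → ∀ n → N ℕ.≤ n → q ^ n * K < ε
  below {N} K<N×εt n N≤n = ℚP.*-cancelʳ-<-nonNeg m {{ℚ.nonNegative m≥0}} (begin-strict
    q ^ n * K * m    ≡⟨ solve 3 (λ p k m → p :* k :* m := k :* (p :* m)) refl (q ^ n) K m ⟩
    K * (q ^ n * m)  ≤⟨ ℚP.*-monoˡ-≤-nonNeg K {{ℚ.nonNegative K≥0}} (bernoulli q≥0 (ℚP.<⇒≤ q<1) n) ⟩
    K * 1ℚ           ≡⟨ ℚP.*-identityʳ K ⟩
    K                <⟨ K<N×εt ⟩
    N × (ε * t)      ≤⟨ ×-monoˡ-≤ (ℚP.<⇒≤ εt>0) N≤n ⟩
    n × (ε * t)      ≡⟨ ×-comm-* n ε t ⟨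
    ε * (n × t)      ≤⟨ ℚP.*-monoˡ-≤-nonNeg ε {{ℚ.nonNegative (ℚP.<⇒≤ ε>0)}} n×t≤m ⟩
    ε * m            ∎)
    where
    open ℚ-Solver
    m = 1ℚ + n × t
    n×t≥0 : 0ℚ ≤ n × t
    n×t≥0 = ×-nonNeg (ℚP.<⇒≤ t>0) n
    n×t≤m : n × t ≤ m
    n×t≤m = subst (_≤ m) (ℚP.+-identityˡ (n × t)) (ℚP.+-monoˡ-≤ (n × t) {0ℚ} {1ℚ} (ℚP.≤ᵇ⇒≤ _))
    m≥0 : 0ℚ ≤ m
    m≥0 = ℚP.≤-trans n×t≥0 n×t≤m

_≥1/_ : Vertex → ℕ → Set
(a , d) ≥1/ u = suc d ℕ.≤ u ℕ.* a

label-≥1/ : ∀ u .{{_ : NonZero u}} r → + 1 / u ≤ label r → r ≥1/ u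
label-≥1/ (suc k) (a , d) 1/u≤a/b = ℕP.≤-trans
  (ℤP.drop‿+≤+ (subst₂ ℤ._≤_ (ℤP.*-identityˡ (+ suc d)) (sym (ℤP.pos-* a (suc k))) b≤a*u))
  (ℕP.≤-reflexive (ℕP.*-comm a (suc k)))
  where
  b≤a*u : + 1 ℤ.* + suc d ℤ.≤ + a ℤ.* + suc k
  b≤a*u = ℚᵘP.drop-*≤* (ℚᵘP.≤-respˡ-≃ (toℚᵘ-/ (+ 1) (suc k))
            (ℚᵘP.≤-respʳ-≃ (toℚᵘ-/ (+ a) (suc d)) (ℚP.toℚᵘ-mono-≤ 1/u≤a/b)))

rightChild-≥1/ : ∀ u v .{{_ : NonZero u}} .{{_ : NonZero v}} r → rightChild v r ≥1/ u
rightChild-≥1/ u v (a , d) = ℕP.≤-trans (ℕP.m≤n*m (suc d) v)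
  (ℕP.≤-trans (ℕP.m≤n+m (v ℕ.* suc d) a) (ℕP.m≤n*m (a ℕ.+ v ℕ.* suc d) u))

label-rootOf : ∀ z .{{_ : ℚ.NonNegative z}} → label (rootOf z) ≡ z
label-rootOf z@(mkℚ (+ m) d _) = ℚP.↥p/↧p≡p z

label-rightChild : ∀ v r → label (rightChild v r) ≡ label r + + v / 1
label-rightChild v (a , d) = ℚP.toℚᵘ-injective (begin
  ℚ.toℚᵘ (label (a ℕ.+ v ℕ.* suc d , d))              ≈⟨ toℚᵘ-/ (+ (a ℕ.+ v ℕ.* suc d)) (suc d) ⟩
  mkℚᵘ (+ (a ℕ.+ v ℕ.* suc d)) d                       ≈⟨ ℚᵘ.*≡* cross ⟩
  mkℚᵘ (+ a) d ℚᵘ.+ mkℚᵘ (+ v) 0                       ≈⟨ ℚᵘP.+-cong (toℚᵘ-/ (+ a) (suc d)) (toℚᵘ-/ (+ v) 1) ⟨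
  ℚ.toℚᵘ (label (a , d)) ℚᵘ.+ ℚ.toℚᵘ (+ v / 1)         ≈⟨ ℚP.toℚᵘ-homo-+ (label (a , d)) (+ v / 1) ⟨
  ℚ.toℚᵘ (label (a , d) + + v / 1)                     ∎)
  where
  open import Relation.Binary.Reasoning.Setoid ℚᵘP.≃-setoid
  cross : + (a ℕ.+ v ℕ.* suc d) ℤ.* (+ suc d ℤ.* + 1) ≡ (+ a ℤ.* + 1 ℤ.+ + v ℤ.* + suc d) ℤ.* + suc d
  cross = trans (cong (ℤ._* (+ suc d ℤ.* + 1)) (trans (ℤP.pos-+ a (v ℕ.* suc d)) (cong (ℤ._+_ (+ a)) (ℤP.pos-* v (suc d)))))
    (solve 3 (λ a v b → (a :+ v :* b) :* (b :* con (+ 1)) := (a :* con (+ 1) :+ v :* b) :* b) refl (+ a) (+ v) (+ suc d))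
    where open ℤ-Solver

label-rightChild-sub : ∀ v r r' → label (rightChild v r) - label (rightChild v r') ≡ label r - label r'
label-rightChild-sub v r r' rewrite label-rightChild v r | label-rightChild v r' =
  solve 3 (λ x y w → (x :+ w) :- (y :+ w) := x :- y) refl (label r) (label r') (+ v / 1)
  where open ℚ-Solver

leftFactor : ℕ → Vertex → ℚ
leftFactor u (a , d) = + suc d / suc (u ℕ.* a ℕ.+ d)

leftFactor-nonNeg : ∀ u r → 0ℚ ≤ leftFactor u r
leftFactor-nonNeg u (a , d) = +/≤+/ {0} {1} {suc d} {suc (u ℕ.* a ℕ.+ d)} ℕ.z≤n

leftFactor≤1 : ∀ u r → leftFactor u r ≤ 1ℚ
leftFactor≤1 u (a , d) = +/≤+/ {suc d} {suc (u ℕ.* a ℕ.+ d)} {1} {1} (subst₂ ℕ._≤_ (sym (ℕP.*-identityʳ (suc d))) (sym (ℕP.*-identityˡ _))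
  (ℕ.s≤s (ℕP.m≤n+m d (u ℕ.* a))))

leftFactor≤½ : ∀ u r → r ≥1/ u → leftFactor u r ≤ ½
leftFactor≤½ u (a , d) b≤ua = +/≤+/ {suc d} {suc (u ℕ.* a ℕ.+ d)} {1} {2} (begin
  suc d ℕ.* 2              ≡⟨ trans (ℕP.*-comm (suc d) 2) (cong (suc d ℕ.+_) (ℕP.+-identityʳ (suc d))) ⟩
  suc d ℕ.+ suc d          ≤⟨ ℕP.+-monoˡ-≤ (suc d) b≤ua ⟩
  u ℕ.* a ℕ.+ suc d        ≡⟨ ℕP.+-suc (u ℕ.* a) d ⟩
  suc (u ℕ.* a ℕ.+ d)      ≡⟨ ℕP.*-identityˡ _ ⟨
  1 ℕ.* suc (u ℕ.* a ℕ.+ d) ∎)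
  where open ℕP.≤-Reasoning

label-leftChild-sub : ∀ u r r' → label (leftChild u r) - label (leftChild u r')
                                  ≡ (label r - label r') * (leftFactor u r * leftFactor u r')
label-leftChild-sub u r@(a , d) r'@(a' , d') = ℚP.toℚᵘ-injective (begin
  ℚ.toℚᵘ (label (leftChild u r) - label (leftChild u r'))
    ≈⟨ toℚᵘ-homo-sub (label (leftChild u r)) (label (leftChild u r')) ⟩
  ℚ.toℚᵘ (label (leftChild u r)) ℚᵘ.- ℚ.toℚᵘ (label (leftChild u r'))
    ≈⟨ ℚᵘP.+-cong (toℚᵘ-/ (+ a) (suc B)) (ℚᵘP.-‿cong (toℚᵘ-/ (+ a') (suc B'))) ⟩
  mkℚᵘ (+ a) B ℚᵘ.- mkℚᵘ (+ a') B'
    ≈⟨ ℚᵘ.*≡* (cross (+ a) (+ a') (+ suc d) (+ suc d') (+ u) _ _ (pos-suc a d) (pos-suc a' d')) ⟩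
  (mkℚᵘ (+ a) d ℚᵘ.- mkℚᵘ (+ a') d') ℚᵘ.* (mkℚᵘ (+ suc d) B ℚᵘ.* mkℚᵘ (+ suc d') B')
    ≈⟨ ℚᵘP.*-cong (ℚᵘP.+-cong (toℚᵘ-/ (+ a) (suc d)) (ℚᵘP.-‿cong (toℚᵘ-/ (+ a') (suc d'))))
                  (ℚᵘP.*-cong (toℚᵘ-/ (+ suc d) (suc B)) (toℚᵘ-/ (+ suc d') (suc B'))) ⟨
  (ℚ.toℚᵘ (label r) ℚᵘ.- ℚ.toℚᵘ (label r')) ℚᵘ.* (ℚ.toℚᵘ (leftFactor u r) ℚᵘ.* ℚ.toℚᵘ (leftFactor u r'))
    ≈⟨ ℚᵘP.*-cong (toℚᵘ-homo-sub (label r) (label r')) (ℚP.toℚᵘ-homo-* (leftFactor u r) (leftFactor u r')) ⟨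
  ℚ.toℚᵘ (label r - label r') ℚᵘ.* ℚ.toℚᵘ (leftFactor u r * leftFactor u r')
    ≈⟨ ℚP.toℚᵘ-homo-* (label r - label r') (leftFactor u r * leftFactor u r') ⟨
  ℚ.toℚᵘ ((label r - label r') * (leftFactor u r * leftFactor u r')) ∎)
  where
  open import Relation.Binary.Reasoning.Setoid ℚᵘP.≃-setoid
  B = u ℕ.* a ℕ.+ d
  B' = u ℕ.* a' ℕ.+ d'
  pos-suc : ∀ a d → + suc (u ℕ.* a ℕ.+ d) ≡ + u ℤ.* + a ℤ.+ + suc d
  pos-suc a d = trans (cong +_ (sym (ℕP.+-suc (u ℕ.* a) d)))
    (trans (ℤP.pos-+ (u ℕ.* a) (suc d)) (cong (ℤ._+ + suc d) (ℤP.pos-* u a)))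
  -- a/B − a'/B' = (a/b − a'/b') · (b/B) · (b'/B'), cross-multiplied, where B = u a + b
  cross : ∀ (a a' b b' u B B' : ℤ) → B ≡ u ℤ.* a ℤ.+ b → B' ≡ u ℤ.* a' ℤ.+ b' →
    (a ℤ.* B' ℤ.+ ℤ.- a' ℤ.* B) ℤ.* ((b ℤ.* b') ℤ.* (B ℤ.* B'))
      ≡ ((a ℤ.* b' ℤ.+ ℤ.- a' ℤ.* b) ℤ.* (b ℤ.* b')) ℤ.* (B ℤ.* B')
  cross a a' b b' u _ _ refl refl = solve 5 (λ a a' b b' u →
    (a :* (u :* a' :+ b') :+ :- a' :* (u :* a :+ b)) :* ((b :* b') :* ((u :* a :+ b) :* (u :* a' :+ b')))
      := ((a :* b' :+ :- a' :* b) :* (b :* b')) :* ((u :* a :+ b) :* (u :* a' :+ b'))) refl a a' b b' u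
    where open ℤ-Solver

∣label-leftChild-sub∣≤ : ∀ u {r r' k x} → leftFactor u r * leftFactor u r' ≤ k →
                         ∣ label r - label r' ∣ ≤ x →
                         ∣ label (leftChild u r) - label (leftChild u r') ∣ ≤ x * k
∣label-leftChild-sub∣≤ u {r} {r'} {k} {x} c≤k δ≤x = begin
  ∣ label (leftChild u r) - label (leftChild u r') ∣ ≡⟨ cong ∣_∣ (label-leftChild-sub u r r') ⟩
  ∣ (label r - label r') * c ∣                       ≡⟨ ℚP.∣p*q∣≡∣p∣*∣q∣ (label r - label r') c ⟩
  ∣ label r - label r' ∣ * ∣ c ∣                     ≡⟨ cong (∣ label r - label r' ∣ *_) (ℚP.0≤p⇒∣p∣≡p c≥0) ⟩
  ∣ label r - label r' ∣ * c                         ≤⟨ *-mono-≤-nonNeg (ℚP.0≤∣p∣ _) c≥0 δ≤x c≤k ⟩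
  x * k                                              ∎
  where
  open ℚP.≤-Reasoning
  c = leftFactor u r * leftFactor u r'
  c≥0 = *-nonNeg (leftFactor-nonNeg u r) (leftFactor-nonNeg u r')

sumℚ-++ : ∀ xs ys → sumℚ (xs ++ ys) ≡ sumℚ xs + sumℚ ys
sumℚ-++ []       ys = sym (ℚP.+-identityˡ (sumℚ ys))
sumℚ-++ (x ∷ xs) ys = trans (cong (_+_ x) (sumℚ-++ xs ys)) (sym (ℚP.+-assoc x (sumℚ xs) (sumℚ ys)))

inv2^-suc : ∀ n → inv2^ (suc n) ≡ ½ * inv2^ n
inv2^-suc n = 1/[m*n] 2 (2 ℕ.^ n) {{_}} {{ℕP.m^n≢0 2 n}}

average : ℕ → ℕ → ℕ → Vertex → ℚ
average u v n r = inv2^ n * sumℚ (map label (level u v n r))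

average-zero : ∀ u v r → average u v 0 r ≡ label r
average-zero u v r = trans (ℚP.*-identityˡ (label r + 0ℚ)) (ℚP.+-identityʳ (label r))

average-suc : ∀ u v n r → average u v (suc n) r
                        ≡ ½ * (average u v n (leftChild u r) + average u v n (rightChild v r))
average-suc u v n r = begin
  inv2^ (suc n) * sumℚ (map label (Lₙ ++ Rₙ))
    ≡⟨ cong₂ _*_ (inv2^-suc n) (trans (cong sumℚ (ListP.map-++ label Lₙ Rₙ)) (sumℚ-++ (map label Lₙ) (map label Rₙ))) ⟩
  ½ * inv2^ n * (sumℚ (map label Lₙ) + sumℚ (map label Rₙ))
    ≡⟨ solve 3 (λ i x y → con ½ :* i :* (x :+ y) := con ½ :* (i :* x :+ i :* y)) refl
         (inv2^ n) (sumℚ (map label Lₙ)) (sumℚ (map label Rₙ)) ⟩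
  ½ * (average u v n (leftChild u r) + average u v n (rightChild v r)) ∎
  where
  open ≡-Reasoning
  open ℚ-Solver
  Lₙ = level u v n (leftChild u r)
  Rₙ = level u v n (rightChild v r)

gap : ℕ → ℕ → ℕ → Vertex → Vertex → ℚ
gap u v n r r' = average u v n r - average u v n r'

∣gap-suc∣≤ : ∀ u v n r r' → ∣ gap u v (suc n) r r' ∣
             ≤ ½ * (∣ gap u v n (leftChild u r) (leftChild u r') ∣ + ∣ gap u v n (rightChild v r) (rightChild v r') ∣)
∣gap-suc∣≤ u v n r r' = begin
  ∣ gap u v (suc n) r r' ∣
    ≡⟨ cong ∣_∣ (cong₂ _-_ (average-suc u v n r) (average-suc u v n r')) ⟩
  ∣ ½ * (a + b) - ½ * (a' + b') ∣
    ≡⟨ cong ∣_∣ (solve 4 (λ a b a' b' → con ½ :* (a :+ b) :- con ½ :* (a' :+ b') := con ½ :* ((a :- a') :+ (b :- b')))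
                   refl a b a' b') ⟩
  ∣ ½ * ((a - a') + (b - b')) ∣
    ≡⟨ ℚP.∣p*q∣≡∣p∣*∣q∣ ½ ((a - a') + (b - b')) ⟩
  ½ * ∣ (a - a') + (b - b') ∣
    ≤⟨ ℚP.*-monoˡ-≤-nonNeg ½ (ℚP.∣p+q∣≤∣p∣+∣q∣ (a - a') (b - b')) ⟩
  ½ * (∣ a - a' ∣ + ∣ b - b' ∣) ∎
  where
  open ℚP.≤-Reasoning
  open ℚ-Solver
  a  = average u v n (leftChild u r)
  b  = average u v n (rightChild v r)
  a' = average u v n (leftChild u r')
  b' = average u v n (rightChild v r')

¾ : ℚ
¾ = + 3 / 4

module _ (u v : ℕ) .{{_ : NonZero u}} .{{_ : NonZero v}} where

  mutual
    ∣gap-suc∣≤-leftFactor : ∀ n {r r' k x} → leftFactor u r * leftFactor u r' ≤ k →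
                            ∣ label r - label r' ∣ ≤ x →
                            ∣ gap u v (suc n) r r' ∣ ≤ ½ * (2 × (¾ ^ n * (x * k)) + ¾ ^ n * x)
    ∣gap-suc∣≤-leftFactor n {r} {r'} {x = x} c≤k δ≤x = ℚP.≤-trans (∣gap-suc∣≤ u v n r r')
      (ℚP.*-monoˡ-≤-nonNeg ½ (ℚP.+-mono-≤
        (∣gap∣≤ n (∣label-leftChild-sub∣≤ u {r} {r'} c≤k δ≤x))
        (∣gap∣≤-≥1/ n (rightChild-≥1/ u v r) (rightChild-≥1/ u v r')
          (subst (λ d → ∣ d ∣ ≤ x) (sym (label-rightChild-sub v r r')) δ≤x))))

    ∣gap∣≤ : ∀ n {r r' x} → ∣ label r - label r' ∣ ≤ x → ∣ gap u v n r r' ∣ ≤ 2 × (¾ ^ n * x)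
    ∣gap∣≤ zero {r} {r'} {x} δ≤x = begin
      ∣ gap u v 0 r r' ∣     ≡⟨ cong ∣_∣ (cong₂ _-_ (average-zero u v r) (average-zero u v r')) ⟩
      ∣ label r - label r' ∣ ≤⟨ δ≤x ⟩
      x                      ≤⟨ p≤p+q x (ℚP.≤-trans (ℚP.0≤∣p∣ _) δ≤x) ⟩
      x + x                  ≡⟨ solve 1 (λ x → x :+ x := con 1ℚ :* x :+ (con 1ℚ :* x :+ con 0ℚ)) refl x ⟩
      2 × (¾ ^ 0 * x)        ∎
      where
      open ℚP.≤-Reasoning
      open ℚ-Solver
    ∣gap∣≤ (suc n) {r} {r'} {x} δ≤x = begin
      ∣ gap u v (suc n) r r' ∣
        ≤⟨ ∣gap-suc∣≤-leftFactor n (*-mono-≤-nonNeg (leftFactor-nonNeg u r) (leftFactor-nonNeg u r')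
                                     (leftFactor≤1 u r) (leftFactor≤1 u r')) δ≤x ⟩
      ½ * (2 × (¾ ^ n * (x * (1ℚ * 1ℚ))) + ¾ ^ n * x)
        ≡⟨ solve 2 (λ w x → con ½ :* ((w :* (x :* (con 1ℚ :* con 1ℚ))) :+ ((w :* (x :* (con 1ℚ :* con 1ℚ))) :+ con 0ℚ) :+ w :* x)
                     := con ¾ :* w :* x :+ (con ¾ :* w :* x :+ con 0ℚ)) refl (¾ ^ n) x ⟩
      2 × (¾ ^ suc n * x) ∎
      where
      open ℚP.≤-Reasoning
      open ℚ-Solver

    ∣gap∣≤-≥1/ : ∀ n {r r'} → r ≥1/ u → r' ≥1/ u → ∀ {x} →
                 ∣ label r - label r' ∣ ≤ x → ∣ gap u v n r r' ∣ ≤ ¾ ^ n * x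
    ∣gap∣≤-≥1/ zero {r} {r'} _ _ {x} δ≤x = begin
      ∣ gap u v 0 r r' ∣     ≡⟨ cong ∣_∣ (cong₂ _-_ (average-zero u v r) (average-zero u v r')) ⟩
      ∣ label r - label r' ∣ ≤⟨ δ≤x ⟩
      x                      ≡⟨ ℚP.*-identityˡ x ⟨
      ¾ ^ 0 * x              ∎
      where open ℚP.≤-Reasoning
    ∣gap∣≤-≥1/ (suc n) {r} {r'} r≥1/u r'≥1/u {x} δ≤x = begin
      ∣ gap u v (suc n) r r' ∣
        ≤⟨ ∣gap-suc∣≤-leftFactor n (*-mono-≤-nonNeg (leftFactor-nonNeg u r) (leftFactor-nonNeg u r')
                                     (leftFactor≤½ u r r≥1/u) (leftFactor≤½ u r' r'≥1/u)) δ≤x ⟩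
      ½ * (2 × (¾ ^ n * (x * (½ * ½))) + ¾ ^ n * x)
        ≡⟨ solve 2 (λ w x → con ½ :* ((w :* (x :* (con ½ :* con ½))) :+ ((w :* (x :* (con ½ :* con ½))) :+ con 0ℚ) :+ w :* x)
                     := con ¾ :* w :* x) refl (¾ ^ n) x ⟩
      ¾ ^ suc n * x ∎
      where
      open ℚP.≤-Reasoning
      open ℚ-Solver

1/≤⇒nonNegative : ∀ u .{{_ : NonZero u}} {z} → + 1 / u ≤ z → ℚ.NonNegative z
1/≤⇒nonNegative u 1/u≤z = ℚ.nonNegative (ℚP.≤-trans (+/≤+/ {0} {1} {1} {u} ℕ.z≤n) 1/u≤z)

rootOf-≥1/ : ∀ u .{{_ : NonZero u}} z → + 1 / u ≤ z → rootOf z ≥1/ u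
rootOf-≥1/ u z 1/u≤z = label-≥1/ u (rootOf z)
  (subst (+ 1 / u ≤_) (sym (label-rootOf z {{1/≤⇒nonNegative u 1/u≤z}})) 1/u≤z)

proposition2 : (u v : ℕ) → .{{_ : NonZero u}} → .{{_ : NonZero v}} →
    (z₁ z₂ : ℚ) →
    ((+ 1) ℚ./ u) ≤ z₁ → z₁ ≤ ((+ v) ℚ./ 1) →
    ((+ 1) ℚ./ u) ≤ z₂ → z₂ ≤ ((+ v) ℚ./ 1) →
    (ε : ℚ) → 0ℚ < ε →
    ∃[ N ] ((n : ℕ) → N ℕ.≤ n → ∣ A u v z₁ n - A u v z₂ n ∣ < ε)
proposition2 u v z₁ z₂ 1/u≤z₁ _ 1/u≤z₂ _ ε ε>0 =
  let N , decay = ^*-eventually-< (ℚP.≤ᵇ⇒≤ _) ¾<1 (ℚP.0≤∣p∣ (z₁ - z₂)) ε>0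
  in  N , λ n N≤n → ℚP.≤-<-trans (∣A-A∣≤ n) (decay n N≤n)
  where
  ¾<1 : ¾ < 1ℚ
  ¾<1 = ℚ.*<* (ℤ.+<+ (ℕ.s≤s (ℕ.s≤s (ℕ.s≤s (ℕ.s≤s ℕ.z≤n)))))
  ∣A-A∣≤ : ∀ n → ∣ A u v z₁ n - A u v z₂ n ∣ ≤ ¾ ^ n * ∣ z₁ - z₂ ∣
  ∣A-A∣≤ n = ∣gap∣≤-≥1/ u v n (rootOf-≥1/ u z₁ 1/u≤z₁) (rootOf-≥1/ u z₂ 1/u≤z₂)
    (ℚP.≤-reflexive (cong ∣_∣ (cong₂ _-_ (label-rootOf z₁ {{1/≤⇒nonNegative u 1/u≤z₁}})
                                         (label-rootOf z₂ {{1/≤⇒nonNegative u 1/u≤z₂}}))))
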